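{- Let $G=(V,E)$ be a finite, simple, undirected, unweighted graph, let $h$ be a positive integer, let $v\in V$, and let $u\in N_v^h(G)$ with $s=dis_G(u,v)$ (so $s\le h$). Then $$S_u := N_u^h(G)\setminus\bigl(N_v^{h-s}(G)\cup\{v\}\bigr)\subseteq N_u^h\bigl(G(V\setminus\{v\})\bigr).$$
   Context: For $S\subseteq V$, $G(S)$ denotes the subgraph of $G$ induced by $S$. For a graph $H$ and vertices $x,y$ of $H$, $dis_H(x,y)$ is the shortest-path distance between $x$ and $y$ in $H$ (equal to $+\infty$ if no path exists). For a graph $H$ with vertex set $W$, a vertex $x\in W$ and a nonnegative integer $t$, the $t$-hop neighborhood of $x$ in $H$ is $N_x^{t}(H)=\{y\in W : y\neq x,\ dis_H(x,y)\le t\}$ (so $N_x^0(H)=\emptyset$). -}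

module Defs where

open import Data.Nat using (ℕ; zero; suc; _≤_)
open import Data.Fin using (Fin)
open import Data.Product using (Σ; ∃; _×_; _,_; proj₁)
open import Relation.Nullary using (¬_)
open import Relation.Binary.PropositionalEquality using (_≡_; _≢_)
open import Function.Bundles using (_↔_)

record Graph : Set₁ where
  field
    V      : Set
    Adj    : V → V → Set
    symAdj : ∀ {x y} → Adj x y → Adj y x
    irrefl : ∀ x → ¬ Adj x x
open Graph public

Finite : Graph → Set
Finite G = ∃ λ n → V G ↔ Fin n

data Walk (G : Graph) : V G → V G → ℕ → Set where
  nil  : ∀ x → Walk G x x 0
  cons : ∀ {x y z k} → Adj G x y → Walk G y z k → Walk G x z (suc k)

-- dis_G(x,y) ≤ t  (false when no path exists, i.e. distance +∞)
DisLe : (G : Graph) → V G → V G → ℕ → Set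
DisLe G x y t = ∃ λ k → k ≤ t × Walk G x y k

Dis : (G : Graph) → V G → V G → ℕ → Set
Dis G x y s = Walk G x y s × (∀ k → Walk G x y k → s ≤ k)

N : (G : Graph) → V G → ℕ → V G → Set
N G x t y = y ≢ x × DisLe G x y t

induced : (G : Graph) → (V G → Set) → Graph
induced G P = record
  { V      = Σ (V G) P
  ; Adj    = λ a b → Adj G (proj₁ a) (proj₁ b)
  ; symAdj = symAdj G
  ; irrefl = λ a → irrefl G (proj₁ a)
  }

deleteV : (G : Graph) → V G → Graph
deleteV G v = induced G (λ x → x ≢ v)

module Submission where

-- Take w ∈ N_u^h(G) with w ∉ N_v^{h-s}(G) ∪ {v}, and a walk
-- u = x₀ x₁ … x_k = w in G with k ≤ h (k ≥ 1 since w ≠ u).  Either the walk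
-- never visits v, and then it is a walk of the same length in G(V∖{v}), which
-- is what we want; or it visits v, and then it splits as a walk u → v of some
-- length i followed by a walk v → w of length j with i + j = k.  Since
-- s = dis_G(u,v) we have s ≤ i, hence j ≤ h - s and w ∈ N_v^{h-s}(G),
-- contradicting the choice of w.

open import Defs
open import Data.Nat using (ℕ; zero; suc; _+_; _∸_; _≤_)
open import Data.Nat.Properties using (m+n≤o⇒m≤o∸n; ∸-monoʳ-≤; ≤-trans; +-comm)
open import Data.Fin using () renaming (_≟_ to _≟ᶠ_)
open import Data.Empty using (⊥-elim)
open import Data.Product using (∃; _×_; _,_; proj₁)
open import Data.Sum using (_⊎_; inj₁; inj₂)
open import Function.Properties.Inverse using (Inverse⇒Injection)
open import Relation.Binary.Definitions using (DecidableEquality)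
open import Relation.Binary.PropositionalEquality using (_≡_; _≢_; refl; cong; subst)
open import Relation.Nullary using (¬_; yes; no)
open import Relation.Nullary.Decidable using (via-injection)

finiteDecEq : (G : Graph) → Finite G → DecidableEquality (V G)
finiteDecEq G (n , V↔Fin) = via-injection (Inverse⇒Injection V↔Fin) _≟ᶠ_

ThroughVertex : (G : Graph) → V G → V G → V G → ℕ → Set
ThroughVertex G v x w k =
  ∃ λ i → ∃ λ j → Walk G x v i × Walk G v w j × (i + j ≡ k)

avoidOrThrough : (G : Graph) → DecidableEquality (V G) →
  (v w : V G) (w≢v : w ≢ v) → ∀ {x y k} (x≢v : x ≢ v) →
  Adj G x y → Walk G y w k →
  Walk (deleteV G v) (x , x≢v) (w , w≢v) (suc k) ⊎ ThroughVertex G v x w (suc k)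
avoidOrThrough G _≟_ v w w≢v x≢v xy (nil _) = inj₁ (cons xy (nil (w , w≢v)))
avoidOrThrough G _≟_ v w w≢v {y = y} x≢v xy (cons yz rest) with y ≟ v
... | yes refl = inj₂ (1 , _ , cons xy (nil v) , cons yz rest , refl)
... | no y≢v with avoidOrThrough G _≟_ v w w≢v y≢v yz rest
...   | inj₁ avoiding = inj₁ (cons {y = y , y≢v} xy avoiding)
...   | inj₂ (i , j , toV , fromV , i+j≡k) =
          inj₂ (suc i , j , cons xy toV , fromV , cong suc i+j≡k)

tailBound : ∀ {h s i j k} → i + j ≡ k → k ≤ h → s ≤ i → j ≤ h ∸ s
tailBound {h} {i = i} {j} refl i+j≤h s≤i =
  ≤-trans (m+n≤o⇒m≤o∸n j (subst (_≤ h) (+-comm i j) i+j≤h)) (∸-monoʳ-≤ h s≤i)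

mainTheorem2 : (G : Graph) → Finite G → (h : ℕ) → 1 ≤ h →
    (v u : V G) → (uN : N G v h u) → (s : ℕ) → Dis G u v s →
    (w : V G) → N G u h w → ¬ N G v (h ∸ s) w → (w≢v : w ≢ v) →
    N (deleteV G v) (u , proj₁ uN) h (w , w≢v)
mainTheorem2 G _ h _ v u uN s _ w (w≢u , _ , _ , nil _) _ _ = ⊥-elim (w≢u refl)
mainTheorem2 G finite h _ v u (u≢v , _) s (_ , shortest) w
             (w≢u , suc k , length≤h , cons ux rest) w∉Nv w≢v
  with avoidOrThrough G (finiteDecEq G finite) v w w≢v u≢v ux rest
... | inj₁ avoiding = (λ w≡u → w≢u (cong proj₁ w≡u)) , suc k , length≤h , avoiding
... | inj₂ (i , j , toV , fromV , i+j≡length) =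
        ⊥-elim (w∉Nv (w≢v , j , tailBound i+j≡length length≤h (shortest i toV) , fromV))
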